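{- Let $\Gamma=(V,L)$ be a connected oriented graph (no edge with equal endpoints, at most one edge between two vertices), with $\Delta_\Gamma=\{x_a:=e_{f(a)}-e_{i(a)}:a\in L\}\subset\mathbb R^V$. For $A\subseteq L$ let $\Gamma_A$ be the subgraph with edge set $A$ and vertex set the endpoints of edges in $A$, and call $\Gamma_A$ A-complete if $\mathrm{span}\{x_a:a\in A\}\cap\Delta_\Gamma=\{x_a:a\in A\}$. Then a proper subgraph $\Lambda=\Gamma_A$ ($A\subsetneq L$) is maximal among proper A-complete subgraphs if and only if either (a) $\Lambda$ is connected and is obtained from $\Gamma$ by deleting one vertex together with all edges incident to it, or (b) $\Lambda$ has exactly two connected components and is obtained from $\Gamma$ by deleting a set of edges each of which joins the two components. -}

module Defs where

open import Data.Nat using (ℕ; zero; suc)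
open import Data.Fin using (Fin; zero; suc; _≟_)
open import Data.Fin.Subset using (Subset; _∈_; _∉_; _⊆_)
open import Data.Rational using (ℚ; 0ℚ; 1ℚ; -_; _+_; _*_)
open import Data.Product using (Σ; ∃; _×_; _,_)
open import Data.Sum using (_⊎_)
open import Data.Unit using () renaming (⊤ to ⊤′)
open import Data.Bool using (if_then_else_)
open import Relation.Nullary using (¬_)
open import Relation.Nullary.Decidable using (⌊_⌋)
open import Relation.Binary.PropositionalEquality using (_≡_; _≢_)

-- A finite oriented graph Γ = (V, L) with V = Fin n, L = Fin m;
-- edge a goes from init a (= i(a)) to fin a (= f(a)).
record OrientedGraph : Set where
  field
    n : ℕ
    m : ℕ
    init : Fin m → Fin n
    fin  : Fin m → Fin n
    loopless : ∀ a → init a ≢ fin a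
    simple : ∀ a b →
      ((init a ≡ init b) × (fin a ≡ fin b)) ⊎ ((init a ≡ fin b) × (fin a ≡ init b)) →
      a ≡ b

module _ (Γ : OrientedGraph) where
  open OrientedGraph Γ

  data Reach (E : Fin m → Set) : Fin n → Fin n → Set where
    here : ∀ {u} → Reach E u u
    fwd  : ∀ {w} a → E a → Reach E (fin a) w → Reach E (init a) w
    bwd  : ∀ {w} a → E a → Reach E (init a) w → Reach E (fin a) w

  AllEdges : Fin m → Set
  AllEdges _ = ⊤′

  Connected : Set
  Connected = ∀ u w → Reach AllEdges u w

  Vect : Set
  Vect = Fin n → ℚ

  x : Fin m → Vect
  x a v = if ⌊ v ≟ fin a ⌋ then 1ℚ else (if ⌊ v ≟ init a ⌋ then - 1ℚ else 0ℚ)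

  sumℚ : ∀ {k} → (Fin k → ℚ) → ℚ
  sumℚ {zero}  g = 0ℚ
  sumℚ {suc k} g = g zero + sumℚ (λ j → g (suc j))

  _≗ᵥ_ : Vect → Vect → Set
  u ≗ᵥ w = ∀ v → u v ≡ w v

  InSpan : Subset m → Vect → Set
  InSpan A w = Σ (Fin m → ℚ) λ c →
    (∀ a → a ∉ A → c a ≡ 0ℚ) × (w ≗ᵥ (λ v → sumℚ (λ a → c a * x a v)))

  InΔ : Vect → Set
  InΔ w = ∃ λ b → w ≗ᵥ x b

  Complete : Subset m → Set
  Complete A = ∀ w →
    ((InΔ w × InSpan A w) → ∃ λ a → a ∈ A × (w ≗ᵥ x a)) ×
    ((∃ λ a → a ∈ A × (w ≗ᵥ x a)) → (InΔ w × InSpan A w))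

  Proper : Subset m → Set
  Proper A = ∃ λ a → a ∉ A

  -- Γ_A is maximal among proper A-complete subgraphs
  -- (Γ_A ⊆ Γ_B as subgraphs iff A ⊆ B)
  Maximal : Subset m → Set
  Maximal A = Complete A × Proper A ×
    (∀ B → A ⊆ B → Proper B → Complete B → B ⊆ A)

  Edge∈ : Subset m → Fin m → Set
  Edge∈ A a = a ∈ A

  VertexDeletion : Subset m → Set
  VertexDeletion A = Σ (Fin n) λ v →
    (∀ a → (a ∈ A → (init a ≢ v × fin a ≢ v)) × ((init a ≢ v × fin a ≢ v) → a ∈ A)) ×
    (∀ u w → u ≢ v → w ≢ v → Reach (Edge∈ A) u w)

  -- (b): the graph (V, A) has exactly two connected components (represented by
  -- s and t), and every deleted edge (a ∉ A) joins the two components.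
  TwoComponentCut : Subset m → Set
  TwoComponentCut A = Σ (Fin n) λ s → Σ (Fin n) λ t →
    ¬ Reach (Edge∈ A) s t ×
    (∀ u → Reach (Edge∈ A) u s ⊎ Reach (Edge∈ A) u t) ×
    (∀ a → a ∉ A →
      (Reach (Edge∈ A) (init a) s × Reach (Edge∈ A) (fin a) t) ⊎
      (Reach (Edge∈ A) (init a) t × Reach (Edge∈ A) (fin a) s))

{-# OPTIONS --safe #-}
-- The vector x_b lies in span{x_a : a ∈ A} exactly when the endpoints of b are
-- joined by a path of (V, A): a path gives a telescoping sum, and conversely the
-- indicator of the component of i(b) is orthogonal to every x_a with a ∈ A but
-- not to x_b.  So A is complete iff it is closed, i.e. contains every edge whose
-- endpoints it connects.  If (V, A) has two components, adding any crossing edge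
-- connects Γ, so no proper closed set lies strictly above A.  Conversely, if A is
-- maximal and b ∉ A, the closure of A ∪ {b} is closed and strictly larger, hence
-- is everything; since Γ is connected every vertex then reaches i(b) along a path
-- that uses b at most once, so (V, A) has the two components of i(b) and f(b).
-- A deleted vertex is an isolated vertex of (V, A), so (a) is the case of (b)
-- where one component is a single vertex.
module Submission where

open import Defs
open import Data.Fin.Subset using (Subset)
open import Data.Sum using (_⊎_)
open import Function.Bundles using (_⇔_)

open import Algebra.Bundles using (CommutativeRing)
open import Data.Bool using (if_then_else_)
import Data.Nat as ℕ
open import Data.Fin using (Fin; zero; suc; _≟_)
open import Data.Fin.Subset using (_∈_; _∉_; _⊆_)
open import Data.Fin.Subset.Properties using (_∈?_)
open import Data.List using (List; []; _∷_; filter; allFin)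
import Data.List.Relation.Unary.Any as Any
open import Data.List.Membership.Propositional using () renaming (_∈_ to _∈ₗ_)
open import Data.List.Membership.Propositional.Properties using (∈-filter⁺; ∈-filter⁻; ∈-allFin)
open import Data.Product using (Σ; ∃; _×_; _,_; proj₁; proj₂)
open import Data.Rational using (ℚ; 0ℚ; 1ℚ; _+_; _*_; _-_; -_)
import Data.Rational.Properties as ℚ
open import Data.Rational.Solver using (module +-*-Solver)
open import Data.Sum using (inj₁; inj₂; [_,_])
open import Data.Vec using (tabulate)
open import Data.Vec.Properties using (lookup∘tabulate; []=⇒lookup; lookup⇒[]=)
open import Function.Base using (_∘_)
open import Function.Bundles using (mk⇔)
open import Level using (0ℓ)
open import Relation.Binary.Definitions using () renaming (Decidable to Decidable₂)
open import Relation.Binary.PropositionalEquality using (_≡_; _≢_; refl; sym; trans; cong; cong₂; subst; module ≡-Reasoning)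
open import Relation.Nullary using (¬_; Dec; yes; no; does; contradiction)
open import Relation.Nullary.Decidable using (dec-true; dec-false; does-⇔; map′; _⊎-dec_; _×-dec_)
open import Relation.Unary using (Pred; Decidable; _∪_; ｛_｝)
open import Relation.Unary.Properties using (_∪?_)
open import Algebra.Properties.Semiring.Sum (CommutativeRing.semiring ℚ.+-*-commutativeRing)

open +-*-Solver using (solve; _:+_; _:-_; _:*_; :-_; con; _:=_)

𝟙 : {P : Set} → Dec P → ℚ
𝟙 P? = if does P? then 1ℚ else 0ℚ

𝟙-yes : {P : Set} (P? : Dec P) → P → 𝟙 P? ≡ 1ℚ
𝟙-yes P? p rewrite dec-true P? p = refl

𝟙-no : {P : Set} (P? : Dec P) → ¬ P → 𝟙 P? ≡ 0ℚ
𝟙-no P? ¬p rewrite dec-false P? ¬p = refl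

δ : ∀ {k} → Fin k → Fin k → ℚ
δ u v = 𝟙 (v ≟ u)

∑-*δ : ∀ {k} (f : Fin k → ℚ) (u : Fin k) → ∑[ v < k ] (f v * δ u v) ≡ f u
∑-*δ {ℕ.suc k} f zero = begin
  f zero * 1ℚ + ∑[ v < k ] (f (suc v) * 0ℚ) ≡⟨ cong₂ _+_ (ℚ.*-identityʳ (f zero)) ∑-zero ⟩
  f zero + 0ℚ                               ≡⟨ ℚ.+-identityʳ (f zero) ⟩
  f zero                                    ∎
  where
  open ≡-Reasoning
  ∑-zero : ∑[ v < k ] (f (suc v) * 0ℚ) ≡ 0ℚ
  ∑-zero = trans (sum-cong-≗ {k} (λ v → ℚ.*-zeroʳ (f (suc v)))) (sum-replicate-zero k)
∑-*δ {ℕ.suc k} f (suc u) = trans (cong₂ _+_ (ℚ.*-zeroʳ (f zero)) (∑-*δ (f ∘ suc) u)) (ℚ.+-identityˡ _)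

toSubset : ∀ {k} {P : Pred (Fin k) 0ℓ} → Decidable P → Subset k
toSubset P? = tabulate (does ∘ P?)

module _ {k} {P : Pred (Fin k) 0ℓ} (P? : Decidable P) where

  ∈-toSubset⁺ : ∀ {i} → P i → i ∈ toSubset P?
  ∈-toSubset⁺ {i} p = lookup⇒[]= i _ (trans (lookup∘tabulate (does ∘ P?) i) (dec-true (P? i) p))

  ∈-toSubset⁻ : ∀ {i} → i ∈ toSubset P? → P i
  ∈-toSubset⁻ {i} i∈ with P? i | trans (sym (lookup∘tabulate (does ∘ P?) i)) ([]=⇒lookup i∈)
  ... | yes p | _ = p
  ... | no _  | ()

module _ (Γ : OrientedGraph) where
  open OrientedGraph Γ

  -- Paths

  ReachIn : Subset m → Fin n → Fin n → Set
  ReachIn A = Reach Γ (Edge∈ Γ A)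

  reach-trans : ∀ {E u v w} → Reach Γ E u v → Reach Γ E v w → Reach Γ E u w
  reach-trans here        q = q
  reach-trans (fwd a p r) q = fwd a p (reach-trans r q)
  reach-trans (bwd a p r) q = bwd a p (reach-trans r q)

  reach-sym : ∀ {E u w} → Reach Γ E u w → Reach Γ E w u
  reach-sym here        = here
  reach-sym (fwd a p r) = reach-trans (reach-sym r) (bwd a p here)
  reach-sym (bwd a p r) = reach-trans (reach-sym r) (fwd a p here)

  reach-flat : ∀ {E F : Pred (Fin m) 0ℓ} → (∀ {a} → E a → Reach Γ F (init a) (fin a)) →
               ∀ {u w} → Reach Γ E u w → Reach Γ F u w
  reach-flat h here        = here
  reach-flat h (fwd a p r) = reach-trans (h p) (reach-flat h r)
  reach-flat h (bwd a p r) = reach-trans (reach-sym (h p)) (reach-flat h r)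

  reach-mono : ∀ {E F : Pred (Fin m) 0ℓ} → (∀ {a} → E a → F a) →
               ∀ {u w} → Reach Γ E u w → Reach Γ F u w
  reach-mono h = reach-flat (λ {a} p → fwd a (h p) here)

  module _ (E : Pred (Fin m) 0ℓ) (b : Fin m) where

    ReachAcross : Fin n → Fin n → Set
    ReachAcross u w = Reach Γ E u w
      ⊎ (Reach Γ E u (init b) × Reach Γ E (fin b) w)
      ⊎ (Reach Γ E u (fin b) × Reach Γ E (init b) w)

    reachAcross? : Decidable₂ (Reach Γ E) → Decidable₂ ReachAcross
    reachAcross? R? u w =
      R? u w ⊎-dec (R? u (init b) ×-dec R? (fin b) w) ⊎-dec (R? u (fin b) ×-dec R? (init b) w)

    reach-∪｛｝⁺ : ∀ {u w} → ReachAcross u w → Reach Γ (E ∪ ｛ b ｝) u w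
    reach-∪｛｝⁺ (inj₁ r)                = reach-mono inj₁ r
    reach-∪｛｝⁺ (inj₂ (inj₁ (r₁ , r₂))) = reach-trans (reach-mono inj₁ r₁) (fwd b (inj₂ refl) (reach-mono inj₁ r₂))
    reach-∪｛｝⁺ (inj₂ (inj₂ (r₁ , r₂))) = reach-trans (reach-mono inj₁ r₁) (bwd b (inj₂ refl) (reach-mono inj₁ r₂))

    ∷-reachAcross : ∀ {u v w} → Reach Γ E u v → ReachAcross v w → ReachAcross u w
    ∷-reachAcross p (inj₁ r)                = inj₁ (reach-trans p r)
    ∷-reachAcross p (inj₂ (inj₁ (r₁ , r₂))) = inj₂ (inj₁ (reach-trans p r₁ , r₂))
    ∷-reachAcross p (inj₂ (inj₂ (r₁ , r₂))) = inj₂ (inj₂ (reach-trans p r₁ , r₂))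

    reachAcross-fwd : ∀ {w} → ReachAcross (fin b) w → ReachAcross (init b) w
    reachAcross-fwd (inj₁ r)               = inj₂ (inj₁ (here , r))
    reachAcross-fwd (inj₂ (inj₁ (_ , r)))  = inj₂ (inj₁ (here , r))
    reachAcross-fwd (inj₂ (inj₂ (_ , r)))  = inj₁ r

    reachAcross-bwd : ∀ {w} → ReachAcross (init b) w → ReachAcross (fin b) w
    reachAcross-bwd (inj₁ r)               = inj₂ (inj₂ (here , r))
    reachAcross-bwd (inj₂ (inj₁ (_ , r)))  = inj₁ r
    reachAcross-bwd (inj₂ (inj₂ (_ , r)))  = inj₂ (inj₂ (here , r))

    reach-∪｛｝⁻ : ∀ {u w} → Reach Γ (E ∪ ｛ b ｝) u w → ReachAcross u w
    reach-∪｛｝⁻ here                 = inj₁ here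
    reach-∪｛｝⁻ (fwd a (inj₁ p) r)    = ∷-reachAcross (fwd a p here) (reach-∪｛｝⁻ r)
    reach-∪｛｝⁻ (bwd a (inj₁ p) r)    = ∷-reachAcross (bwd a p here) (reach-∪｛｝⁻ r)
    reach-∪｛｝⁻ (fwd a (inj₂ refl) r) = reachAcross-fwd (reach-∪｛｝⁻ r)
    reach-∪｛｝⁻ (bwd a (inj₂ refl) r) = reachAcross-bwd (reach-∪｛｝⁻ r)

  reach-[]⇒≡ : ∀ {u w} → Reach Γ (_∈ₗ []) u w → u ≡ w
  reach-[]⇒≡ here = refl

  reach-∈ₗ? : (es : List (Fin m)) → Decidable₂ (Reach Γ (_∈ₗ es))
  reach-∈ₗ? []       u w = map′ (λ { refl → here }) reach-[]⇒≡ (u ≟ w)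
  reach-∈ₗ? (a ∷ es) u w = map′
    (reach-mono ∪｛｝⇒∷ ∘ reach-∪｛｝⁺ (_∈ₗ es) a)
    (reach-∪｛｝⁻ (_∈ₗ es) a ∘ reach-mono ∷⇒∪｛｝)
    (reachAcross? (_∈ₗ es) a (reach-∈ₗ? es) u w)
    where
    ∪｛｝⇒∷ : ∀ {e} → e ∈ₗ es ⊎ a ≡ e → e ∈ₗ a ∷ es
    ∪｛｝⇒∷ = [ Any.there , Any.here ∘ sym ]
    ∷⇒∪｛｝ : ∀ {e} → e ∈ₗ a ∷ es → e ∈ₗ es ⊎ a ≡ e
    ∷⇒∪｛｝ (Any.here e≡a) = inj₂ (sym e≡a)
    ∷⇒∪｛｝ (Any.there p)  = inj₁ p

  reach? : ∀ {E : Pred (Fin m) 0ℓ} → Decidable E → Decidable₂ (Reach Γ E)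
  reach? E? u w = map′
    (reach-mono (λ p → proj₂ (∈-filter⁻ E? {xs = allFin m} p)))
    (reach-mono (λ {a} → ∈-filter⁺ E? (∈-allFin a)))
    (reach-∈ₗ? (filter E? (allFin m)) u w)

  reachIn? : ∀ A → Decidable₂ (ReachIn A)
  reachIn? A = reach? (_∈? A)

  Closed : Subset m → Set
  Closed A = ∀ a → ReachIn A (init a) (fin a) → a ∈ A

  closure : ∀ {E : Pred (Fin m) 0ℓ} → Decidable E → Subset m
  closure E? = toSubset (λ a → reach? E? (init a) (fin a))

  module _ {E : Pred (Fin m) 0ℓ} (E? : Decidable E) where

    private
      reach-ends? : Decidable (λ a → Reach Γ E (init a) (fin a))
      reach-ends? a = reach? E? (init a) (fin a)

    ⊆-closure : ∀ {a} → E a → a ∈ closure E?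
    ⊆-closure {a} p = ∈-toSubset⁺ reach-ends? (fwd a p here)

    reach-closure : ∀ {u w} → ReachIn (closure E?) u w → Reach Γ E u w
    reach-closure = reach-flat (∈-toSubset⁻ reach-ends?)

    closure-closed : Closed (closure E?)
    closure-closed a = ∈-toSubset⁺ reach-ends? ∘ reach-closure

  -- The span of the edge vectors

  sumℚ≡sum : ∀ {k} (f : Fin k → ℚ) → sumℚ Γ f ≡ sum f
  sumℚ≡sum {ℕ.zero}  f = refl
  sumℚ≡sum {ℕ.suc k} f = cong (f zero +_) (sumℚ≡sum (f ∘ suc))

  combination≡∑ : ∀ (c : Fin m → ℚ) v → sumℚ Γ (λ a → c a * x Γ a v) ≡ ∑[ a < m ] (c a * x Γ a v)
  combination≡∑ c v = sumℚ≡sum (λ a → c a * x Γ a v)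

  x≡δ-δ : ∀ a v → x Γ a v ≡ δ (fin a) v - δ (init a) v
  x≡δ-δ a v with v ≟ fin a | v ≟ init a
  ... | yes refl | yes f≡i = contradiction (sym f≡i) (loopless a)
  ... | yes _    | no _    = refl
  ... | no _     | yes _   = refl
  ... | no _     | no _    = refl

  x≡1⇒fin : ∀ a v → x Γ a v ≡ 1ℚ → v ≡ fin a
  x≡1⇒fin a v with v ≟ fin a | v ≟ init a
  ... | yes v≡f | _     = λ _ → v≡f
  ... | no _    | yes _ = λ ()
  ... | no _    | no _  = λ ()

  x≡-1⇒init : ∀ a v → x Γ a v ≡ - 1ℚ → v ≡ init a
  x≡-1⇒init a v with v ≟ fin a | v ≟ init a
  ... | yes _ | _       = λ ()
  ... | no _  | yes v≡i = λ _ → v≡i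
  ... | no _  | no _    = λ ()

  x-fin : ∀ a → x Γ a (fin a) ≡ 1ℚ
  x-fin a with fin a ≟ fin a
  ... | yes _  = refl
  ... | no f≢f = contradiction refl f≢f

  x-init : ∀ a → x Γ a (init a) ≡ - 1ℚ
  x-init a with init a ≟ fin a | init a ≟ init a
  ... | yes i≡f | _      = contradiction i≡f (loopless a)
  ... | no _    | yes _  = refl
  ... | no _    | no i≢i = contradiction refl i≢i

  x-injective : ∀ {a b} → _≗ᵥ_ Γ (x Γ a) (x Γ b) → a ≡ b
  x-injective {a} {b} xa≗xb = simple a b (inj₁ (init-eq , fin-eq))
    where
    init-eq : init a ≡ init b
    init-eq = x≡-1⇒init b (init a) (trans (sym (xa≗xb (init a))) (x-init a))
    fin-eq : fin a ≡ fin b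
    fin-eq = x≡1⇒fin b (fin a) (trans (sym (xa≗xb (fin a))) (x-fin a))

  ⟨_,_⟩ : Vect Γ → Vect Γ → ℚ
  ⟨ φ , w ⟩ = ∑[ v < n ] (φ v * w v)

  ⟨,x⟩ : ∀ φ a → ⟨ φ , x Γ a ⟩ ≡ φ (fin a) - φ (init a)
  ⟨,x⟩ φ a = begin
    ⟨ φ , x Γ a ⟩
      ≡⟨ solve 2 (λ p q → p := (p :+ q) :- q) refl _ _ ⟩
    (⟨ φ , x Γ a ⟩ + ⟨ φ , δ (init a) ⟩) - ⟨ φ , δ (init a) ⟩
      ≡⟨ cong (_- ⟨ φ , δ (init a) ⟩) (∑-distrib-+ (λ v → φ v * x Γ a v) (λ v → φ v * δ (init a) v)) ⟨
    ∑[ v < n ] (φ v * x Γ a v + φ v * δ (init a) v) - ⟨ φ , δ (init a) ⟩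
      ≡⟨ cong (_- ⟨ φ , δ (init a) ⟩) (sum-cong-≗ {n} x+δ) ⟩
    ⟨ φ , δ (fin a) ⟩ - ⟨ φ , δ (init a) ⟩
      ≡⟨ cong₂ _-_ (∑-*δ φ (fin a)) (∑-*δ φ (init a)) ⟩
    φ (fin a) - φ (init a)
      ∎
    where
    open ≡-Reasoning
    x+δ : ∀ v → φ v * x Γ a v + φ v * δ (init a) v ≡ φ v * δ (fin a) v
    x+δ v rewrite x≡δ-δ a v =
      solve 3 (λ p q r → p :* (q :- r) :+ p :* r := p :* q) refl (φ v) (δ (fin a) v) (δ (init a) v)

  span-resp : ∀ {A u w} → _≗ᵥ_ Γ u w → InSpan Γ A w → InSpan Γ A u
  span-resp u≗w (c , c-out , w≗) = c , c-out , λ v → trans (u≗w v) (w≗ v)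

  span-zero : ∀ A → InSpan Γ A (λ _ → 0ℚ)
  span-zero A = (λ _ → 0ℚ) , (λ _ _ → refl) , λ v → sym (begin
    sumℚ Γ (λ a → 0ℚ * x Γ a v) ≡⟨ combination≡∑ (λ _ → 0ℚ) v ⟩
    ∑[ a < m ] (0ℚ * x Γ a v)   ≡⟨ sum-cong-≗ {m} (λ a → ℚ.*-zeroˡ (x Γ a v)) ⟩
    ∑[ a < m ] 0ℚ               ≡⟨ sum-replicate-zero m ⟩
    0ℚ                          ∎)
    where open ≡-Reasoning

  span-+ : ∀ {A u w} → InSpan Γ A u → InSpan Γ A w → InSpan Γ A (λ v → u v + w v)
  span-+ {u = u} {w} (c , c-out , u≗) (d , d-out , w≗) =
    (λ a → c a + d a) , (λ a a∉A → cong₂ _+_ (c-out a a∉A) (d-out a a∉A)) , λ v → begin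
      u v + w v
        ≡⟨ cong₂ _+_ (u≗ v) (w≗ v) ⟩
      sumℚ Γ (λ a → c a * x Γ a v) + sumℚ Γ (λ a → d a * x Γ a v)
        ≡⟨ cong₂ _+_ (combination≡∑ c v) (combination≡∑ d v) ⟩
      ∑[ a < m ] (c a * x Γ a v) + ∑[ a < m ] (d a * x Γ a v)
        ≡⟨ ∑-distrib-+ (λ a → c a * x Γ a v) (λ a → d a * x Γ a v) ⟨
      ∑[ a < m ] (c a * x Γ a v + d a * x Γ a v)
        ≡⟨ sum-cong-≗ {m} (λ a → ℚ.*-distribʳ-+ (x Γ a v) (c a) (d a)) ⟨
      ∑[ a < m ] ((c a + d a) * x Γ a v)
        ≡⟨ combination≡∑ (λ a → c a + d a) v ⟨
      sumℚ Γ (λ a → (c a + d a) * x Γ a v)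
        ∎
    where open ≡-Reasoning

  span-* : ∀ {A w} q → InSpan Γ A w → InSpan Γ A (λ v → q * w v)
  span-* {w = w} q (c , c-out , w≗) =
    (λ a → q * c a) , (λ a a∉A → trans (cong (q *_) (c-out a a∉A)) (ℚ.*-zeroʳ q)) , λ v → begin
      q * w v                              ≡⟨ cong (q *_) (trans (w≗ v) (combination≡∑ c v)) ⟩
      q * ∑[ a < m ] (c a * x Γ a v)       ≡⟨ *-distribˡ-sum q (λ a → c a * x Γ a v) ⟩
      ∑[ a < m ] (q * (c a * x Γ a v))     ≡⟨ sum-cong-≗ {m} (λ a → ℚ.*-assoc q (c a) (x Γ a v)) ⟨
      ∑[ a < m ] (q * c a * x Γ a v)       ≡⟨ combination≡∑ (λ a → q * c a) v ⟨
      sumℚ Γ (λ a → q * c a * x Γ a v)     ∎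
    where open ≡-Reasoning

  x∈span : ∀ {A a} → a ∈ A → InSpan Γ A (x Γ a)
  x∈span {A} {a} a∈A = δ a , δ-out , λ v → sym (begin
    sumℚ Γ (λ b → δ a b * x Γ b v)   ≡⟨ combination≡∑ (δ a) v ⟩
    ∑[ b < m ] (δ a b * x Γ b v)     ≡⟨ sum-cong-≗ {m} (λ b → ℚ.*-comm (δ a b) (x Γ b v)) ⟩
    ∑[ b < m ] (x Γ b v * δ a b)     ≡⟨ ∑-*δ (λ b → x Γ b v) a ⟩
    x Γ a v                          ∎)
    where
    open ≡-Reasoning
    δ-out : ∀ b → b ∉ A → δ a b ≡ 0ℚ
    δ-out b b∉A = 𝟙-no (b ≟ a) (λ { refl → b∉A a∈A })

  reach⇒span : ∀ {A u w} → ReachIn A u w → InSpan Γ A (λ v → δ w v - δ u v)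
  reach⇒span {A} here = span-resp (λ v → ℚ.+-inverseʳ (δ _ v)) (span-zero A)
  reach⇒span {w = w} (fwd a a∈A r) =
    span-resp telescope (span-+ (reach⇒span r) (x∈span a∈A))
    where
    telescope : ∀ v → δ w v - δ (init a) v ≡ (δ w v - δ (fin a) v) + x Γ a v
    telescope v rewrite x≡δ-δ a v =
      solve 3 (λ p q r → p :- r := (p :- q) :+ (q :- r)) refl
        (δ w v) (δ (fin a) v) (δ (init a) v)
  reach⇒span {w = w} (bwd a a∈A r) =
    span-resp telescope (span-+ (reach⇒span r) (span-* (- 1ℚ) (x∈span a∈A)))
    where
    telescope : ∀ v → δ w v - δ (fin a) v ≡ (δ w v - δ (init a) v) + - 1ℚ * x Γ a v
    telescope v rewrite x≡δ-δ a v =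
      solve 3 (λ p q r → p :- q := (p :- r) :+ (:- con 1ℚ) :* (q :- r)) refl
        (δ w v) (δ (fin a) v) (δ (init a) v)

  span⊥potential : ∀ {A w} (φ : Vect Γ) → (∀ a → a ∈ A → φ (init a) ≡ φ (fin a)) →
                   InSpan Γ A w → ⟨ φ , w ⟩ ≡ 0ℚ
  span⊥potential {A} {w} φ φ-const (c , c-out , w≗) = begin
    ⟨ φ , w ⟩
      ≡⟨ sum-cong-≗ {n} (λ v → cong (φ v *_) (trans (w≗ v) (combination≡∑ c v))) ⟩
    ∑[ v < n ] (φ v * ∑[ a < m ] (c a * x Γ a v))
      ≡⟨ sum-cong-≗ {n} (λ v → *-distribˡ-sum (φ v) (λ a → c a * x Γ a v)) ⟩
    ∑[ v < n ] ∑[ a < m ] (φ v * (c a * x Γ a v))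
      ≡⟨ ∑-comm {n} {m} _ ⟩
    ∑[ a < m ] ∑[ v < n ] (φ v * (c a * x Γ a v))
      ≡⟨ sum-cong-≗ {m} (λ a → sum-cong-≗ {n} (λ v → swap (φ v) (c a) (x Γ a v))) ⟩
    ∑[ a < m ] ∑[ v < n ] (c a * (φ v * x Γ a v))
      ≡⟨ sum-cong-≗ {m} (λ a → *-distribˡ-sum (c a) (λ v → φ v * x Γ a v)) ⟨
    ∑[ a < m ] (c a * ⟨ φ , x Γ a ⟩)
      ≡⟨ sum-cong-≗ {m} vanish ⟩
    ∑[ a < m ] 0ℚ
      ≡⟨ sum-replicate-zero m ⟩
    0ℚ
      ∎
    where
    open ≡-Reasoning
    swap : ∀ p q r → p * (q * r) ≡ q * (p * r)
    swap = solve 3 (λ p q r → p :* (q :* r) := q :* (p :* r)) refl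
    vanish : ∀ a → c a * ⟨ φ , x Γ a ⟩ ≡ 0ℚ
    vanish a with a ∈? A
    ... | yes a∈A = begin
      c a * ⟨ φ , x Γ a ⟩            ≡⟨ cong (c a *_) (⟨,x⟩ φ a) ⟩
      c a * (φ (fin a) - φ (init a)) ≡⟨ cong (λ y → c a * (φ (fin a) - y)) (φ-const a a∈A) ⟩
      c a * (φ (fin a) - φ (fin a))  ≡⟨ cong (c a *_) (ℚ.+-inverseʳ (φ (fin a))) ⟩
      c a * 0ℚ                       ≡⟨ ℚ.*-zeroʳ (c a) ⟩
      0ℚ                             ∎
    ... | no a∉A = trans (cong (_* ⟨ φ , x Γ a ⟩) (c-out a a∉A)) (ℚ.*-zeroˡ ⟨ φ , x Γ a ⟩)

  span⇒reach : ∀ {A} b → InSpan Γ A (x Γ b) → ReachIn A (init b) (fin b)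
  span⇒reach {A} b x∈ with reachIn? A (init b) (fin b)
  ... | yes r = r
  ... | no ¬r = contradiction (begin
    - 1ℚ                       ≡⟨ cong₂ _-_ (𝟙-no (component (fin b)) ¬r) (𝟙-yes (component (init b)) here) ⟨
    φ (fin b) - φ (init b)     ≡⟨ ⟨,x⟩ φ b ⟨
    ⟨ φ , x Γ b ⟩              ≡⟨ span⊥potential φ φ-const x∈ ⟩
    0ℚ                         ∎) λ ()
    where
    open ≡-Reasoning
    component : ∀ v → Dec (ReachIn A (init b) v)
    component = reachIn? A (init b)
    φ : Vect Γ
    φ v = 𝟙 (component v)
    φ-const : ∀ a → a ∈ A → φ (init a) ≡ φ (fin a)
    φ-const a a∈A = cong (if_then 1ℚ else 0ℚ) (does-⇔
      (mk⇔ (λ r → reach-trans r (fwd a a∈A here)) (λ r → reach-trans r (bwd a a∈A here)))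
      (component (init a)) (component (fin a)))

  complete⇒closed : ∀ {A} → Complete Γ A → Closed A
  complete⇒closed {A} complete b r
    with proj₁ (complete (x Γ b)) ((b , λ _ → refl) , span-resp (x≡δ-δ b) (reach⇒span r))
  ... | a , a∈A , xb≗xa = subst (_∈ A) (x-injective (sym ∘ xb≗xa)) a∈A

  closed⇒complete : ∀ {A} → Closed A → Complete Γ A
  closed⇒complete {A} closed w = to , from
    where
    to : InΔ Γ w × InSpan Γ A w → ∃ λ a → a ∈ A × _≗ᵥ_ Γ w (x Γ a)
    to ((b , w≗xb) , w∈) = b , closed b (span⇒reach b (span-resp (sym ∘ w≗xb) w∈)) , w≗xb
    from : (∃ λ a → a ∈ A × _≗ᵥ_ Γ w (x Γ a)) → InΔ Γ w × InSpan Γ A w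
    from (a , a∈A , w≗xa) = (a , w≗xa) , span-resp w≗xa (x∈span a∈A)

  -- Closed edge sets and two-component cuts

  closed⇒cut : ∀ {A s t} → Closed A → ¬ ReachIn A s t → (∀ u → ReachIn A u s ⊎ ReachIn A u t) →
               TwoComponentCut Γ A
  closed⇒cut {A} {s} {t} closed ¬s~t cover = s , t , ¬s~t , cover , crossing
    where
    crossing : ∀ a → a ∉ A →
      (ReachIn A (init a) s × ReachIn A (fin a) t) ⊎ (ReachIn A (init a) t × ReachIn A (fin a) s)
    crossing a a∉A with cover (init a) | cover (fin a)
    ... | inj₁ i~s | inj₁ f~s = contradiction (closed a (reach-trans i~s (reach-sym f~s))) a∉A
    ... | inj₁ i~s | inj₂ f~t = inj₁ (i~s , f~t)
    ... | inj₂ i~t | inj₁ f~s = inj₂ (i~t , f~s)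
    ... | inj₂ i~t | inj₂ f~t = contradiction (closed a (reach-trans i~t (reach-sym f~t))) a∉A

  cut⇒closed : ∀ {A} → TwoComponentCut Γ A → Closed A
  cut⇒closed {A} (s , t , ¬s~t , _ , crossing) b r with b ∈? A
  ... | yes b∈A = b∈A
  ... | no b∉A with crossing b b∉A
  ...   | inj₁ (i~s , f~t) = contradiction (reach-trans (reach-sym i~s) (reach-trans r f~t)) ¬s~t
  ...   | inj₂ (i~t , f~s) = contradiction (reach-trans (reach-sym f~s) (reach-trans (reach-sym r) i~t)) ¬s~t

  cut+crossing⇒connected : ∀ {A B} → TwoComponentCut Γ A → A ⊆ B →
                             ∀ {a} → a ∉ A → a ∈ B → ∀ u w → ReachIn B u w
  cut+crossing⇒connected {A} {B} (s , t , _ , cover , crossing) A⊆B {a} a∉A a∈B u w =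
    reach-trans (to-s u) (reach-sym (to-s w))
    where
    lift : ∀ {u w} → ReachIn A u w → ReachIn B u w
    lift = reach-mono A⊆B
    t~s : ReachIn B t s
    t~s with crossing a a∉A
    ... | inj₁ (i~s , f~t) = reach-trans (reach-sym (lift f~t)) (bwd a a∈B (lift i~s))
    ... | inj₂ (i~t , f~s) = reach-trans (reach-sym (lift i~t)) (fwd a a∈B (lift f~s))
    to-s : ∀ u → ReachIn B u s
    to-s u = [ lift , (λ u~t → reach-trans (lift u~t) t~s) ] (cover u)

  cut⇒maximal : ∀ {A} → Proper Γ A → TwoComponentCut Γ A → Maximal Γ A
  cut⇒maximal {A} proper cut = closed⇒complete (cut⇒closed cut) , proper , maximal
    where
    maximal : ∀ B → A ⊆ B → Proper Γ B → Complete Γ B → B ⊆ A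
    maximal B A⊆B (f , f∉B) complete {a} a∈B with a ∈? A
    ... | yes a∈A = a∈A
    ... | no a∉A = contradiction
      (complete⇒closed complete f
        (cut+crossing⇒connected cut A⊆B a∉A a∈B (init f) (fin f)))
      f∉B

  deletion⇒cut : ∀ {A} → Proper Γ A → VertexDeletion Γ A → TwoComponentCut Γ A
  deletion⇒cut {A} (b , b∉A) (v , incident , connected) =
    closed⇒cut closed (λ v~t → t≢v (isolated v~t refl)) cover
    where
    isolated : ∀ {u w} → ReachIn A u w → u ≡ v → w ≡ v
    isolated here        u≡v = u≡v
    isolated (fwd a p _) i≡v = contradiction i≡v (proj₁ (proj₁ (incident a) p))
    isolated (bwd a p _) f≡v = contradiction f≡v (proj₂ (proj₁ (incident a) p))
    deleted-touches-v : ∀ a → a ∉ A → init a ≡ v ⊎ fin a ≡ v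
    deleted-touches-v a a∉A with init a ≟ v | fin a ≟ v
    ... | yes i≡v | _       = inj₁ i≡v
    ... | no _    | yes f≡v = inj₂ f≡v
    ... | no i≢v  | no f≢v  = contradiction (proj₂ (incident a) (i≢v , f≢v)) a∉A
    closed : Closed A
    closed a r with a ∈? A
    ... | yes a∈A = a∈A
    ... | no a∉A with deleted-touches-v a a∉A
    ...   | inj₁ i≡v = contradiction (trans i≡v (sym (isolated r i≡v))) (loopless a)
    ...   | inj₂ f≡v = contradiction (trans (isolated (reach-sym r) f≡v) (sym f≡v)) (loopless a)
    other-end : Σ (Fin n) (_≢ v)
    other-end with deleted-touches-v b b∉A
    ... | inj₁ i≡v = fin b , λ f≡v → loopless b (trans i≡v (sym f≡v))
    ... | inj₂ f≡v = init b , λ i≡v → loopless b (trans i≡v (sym f≡v))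
    t : Fin n
    t = proj₁ other-end
    t≢v : t ≢ v
    t≢v = proj₂ other-end
    cover : ∀ u → ReachIn A u v ⊎ ReachIn A u t
    cover u with u ≟ v
    ... | yes refl = inj₁ here
    ... | no u≢v   = inj₂ (connected u t u≢v t≢v)

  maximal⇒cut : ∀ {A} → Connected Γ → Maximal Γ A → TwoComponentCut Γ A
  maximal⇒cut {A} connected (complete , (b , b∉A) , maximal) =
    closed⇒cut closed (λ r → b∉A (closed b r)) cover
    where
    closed : Closed A
    closed = complete⇒closed complete
    A∪b? : Decidable (Edge∈ Γ A ∪ ｛ b ｝)
    A∪b? = (_∈? A) ∪? (b ≟_)
    B : Subset m
    B = closure A∪b?
    B-total : ∀ a → a ∈ B
    B-total a with a ∈? B
    ... | yes a∈B = a∈B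
    ... | no a∉B = contradiction
      (maximal B (⊆-closure A∪b? ∘ inj₁) (a , a∉B)
        (closed⇒complete (closure-closed A∪b?)) (⊆-closure A∪b? (inj₂ refl)))
      b∉A
    cover : ∀ u → ReachIn A u (init b) ⊎ ReachIn A u (fin b)
    cover u
      with reach-∪｛｝⁻ (Edge∈ Γ A) b (reach-closure A∪b? (reach-mono (λ {a} _ → B-total a) (connected u (init b))))
    ... | inj₁ u~i              = inj₁ u~i
    ... | inj₂ (inj₁ (u~i , _)) = inj₁ u~i
    ... | inj₂ (inj₂ (u~f , _)) = inj₂ u~f

mainTheorem5 : (Γ : OrientedGraph) → Connected Γ →
    (A : Subset (OrientedGraph.m Γ)) → Proper Γ A →
    Maximal Γ A ⇔ (VertexDeletion Γ A ⊎ TwoComponentCut Γ A)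
mainTheorem5 Γ connected _ proper = mk⇔
  (inj₂ ∘ maximal⇒cut Γ connected)
  [ cut⇒maximal Γ proper ∘ deletion⇒cut Γ proper , cut⇒maximal Γ proper ]
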